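{- Let $u<_k w$ in the $k$-Bruhat order and consider a maximal chain $u=u_0<_k u_1<_k\cdots<_k u_n=w$ of $[u,w]_k$, with $u_i=u_{i-1}(a_i\,b_i)$ and $a_i\le k<b_i$. Then this chain is the CM-chain of $[u,w]_k$ if and only if it has no inversions.
   Context: $\mathcal S_\infty$ is the group of permutations of $\{1,2,\dots\}$ fixing all but finitely many points; $\ell(w)$ is the number of inversions; $u(a\,b)$ is $u$ composed on the right with the transposition of $a,b$. For a positive integer $k$, the $k$-Bruhat order $\le_k$ is the reflexive–transitive closure of the covers $u<_k u(a\,b)$ with $a\le k<b$ and $\ell(u(a\,b))=\ell(u)+1$; $[u,w]_k$ is an interval. CM-chain of $[u,w]_k$ (for $u<_k w$), defined recursively: if $\ell(w)=\ell(u)+1$ it is the chain $u<_k w$. If $\ell(w)>\ell(u)+1$, there are (as is known) unique integers $a\le k<b$ such that (I) $u(a)<w(a)$ and $w(a)=\max\{w(j): j\le k,\ u(j)<w(j)\}$, and (II) $u(b)>u(a)\ge w(b)$ and $w(b)=\min\{w(j): j>k,\ u(j)>u(a)\ge w(j)\}$; with $u_1=u(a\,b)$, the CM-chain of $[u,w]_k$ is $u<_k u_1<_k\cdots<_k w$ where $u_1<_k\cdots<_k w$ is the CM-chain of $[u_1,w]_k$. An inversion of a maximal chain as in the claim is a pair $(i,j)$ with $1\le i<j\le n$ such that either $w(a_i)<w(a_j)$, or $w(a_i)=w(a_j)$ and $w(b_i)>w(b_j)$. -}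

module Defs where

open import Data.Nat using (ℕ; zero; suc; _≤_; _<_; _<ᵇ_; _≡ᵇ_)
open import Data.Bool using (if_then_else_)
open import Data.List using (List; []; _∷_; map; upTo)
open import Data.Nat.ListAction using (sum)
open import Data.List.Relation.Unary.AllPairs using (AllPairs)
open import Data.Product using (_×_; _,_; Σ-syntax)
open import Data.Sum using (_⊎_)
open import Data.Empty using (⊥)
open import Data.Unit using (⊤)
open import Relation.Nullary using (¬_)
open import Relation.Binary.PropositionalEquality using (_≡_; _≗_)
open import Relation.Binary.Construct.Closure.ReflexiveTransitive using (Star)

-- Elements of S_∞ : permutations of {1,2,...}.  We use ℕ as the carrier
-- and require the extra point 0 to be fixed, so these are exactly the
-- finitary permutations of {1,2,...}.
record Perm : Set where
  field
    fun      : ℕ → ℕ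
    inv      : ℕ → ℕ
    inv-fun  : ∀ i → inv (fun i) ≡ i
    fun-inv  : ∀ i → fun (inv i) ≡ i
    fix-zero : fun 0 ≡ 0
    bound    : ℕ
    fix-big  : ∀ i → bound ≤ i → fun i ≡ i

open Perm public

invCount : (ℕ → ℕ) → ℕ → ℕ
invCount f N =
  sum (map (λ j → sum (map (λ i → if f j <ᵇ f i then 1 else 0) (upTo j))) (upTo N))

-- ℓ(w) : number of inversions (all inversions lie below the support bound)
ℓ : Perm → ℕ
ℓ w = invCount (fun w) (bound w)

swap : ℕ → ℕ → ℕ → ℕ
swap a b i = if i ≡ᵇ a then b else (if i ≡ᵇ b then a else i)

Cover : ℕ → ℕ → ℕ → Perm → Perm → Set
Cover k a b u v =
  1 ≤ a × a ≤ k × k < b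
  × (∀ i → fun v i ≡ fun u (swap a b i))
  × ℓ v ≡ suc (ℓ u)

_≤[_]_ : Perm → ℕ → Perm → Set
u ≤[ k ] w = Star (λ x y → Σ[ a ∈ ℕ ] Σ[ b ∈ ℕ ] Cover k a b x y) u w

_<[_]_ : Perm → ℕ → Perm → Set
u <[ k ] w = u ≤[ k ] w × ¬ (fun u ≗ fun w)

data Chain (k : ℕ) : Perm → Perm → Set where
  done : ∀ {w} → Chain k w w
  step : ∀ {u v w} (a b : ℕ) → Cover k a b u v → Chain k v w → Chain k u w

labels : ∀ {k u w} → Chain k u w → List (ℕ × ℕ)
labels done = []
labels (step a b _ c) = (a , b) ∷ labels c

IsInversion : Perm → ℕ × ℕ → ℕ × ℕ → Set
IsInversion w (ai , bi) (aj , bj) =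
  fun w ai < fun w aj ⊎ (fun w ai ≡ fun w aj × fun w bj < fun w bi)

NoInversions : ∀ {k u w} → Chain k u w → Set
NoInversions {w = w} c = AllPairs (λ p q → ¬ IsInversion w p q) (labels c)

CondI : ℕ → Perm → Perm → ℕ → Set
CondI k u w a =
  1 ≤ a × a ≤ k × fun u a < fun w a
  × (∀ j → 1 ≤ j → j ≤ k → fun u j < fun w j → fun w j ≤ fun w a)

CondII : ℕ → Perm → Perm → ℕ → ℕ → Set
CondII k u w a b =
  k < b × fun u a < fun u b × fun w b ≤ fun u a
  × (∀ j → k < j → fun u a < fun u j → fun w j ≤ fun u a → fun w b ≤ fun w j)

IsDone : ∀ {k u w} → Chain k u w → Set
IsDone done = ⊤
IsDone (step _ _ _ _) = ⊥

IsCM : ∀ {k u w} → Chain k u w → Set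
IsCM done = ⊥
IsCM {k} {u} {w} (step a b _ c) =
  (ℓ w ≡ suc (ℓ u) × IsDone c)
  ⊎ (suc (ℓ u) < ℓ w × CondI k u w a × CondII k u w a b × IsCM c)

-- Swapping the values at an ascent a < b of a permutation creates one inversion for the pair
-- {a, b} itself and two more for every position strictly between a and b whose value lies
-- strictly between; pairs avoiding {a, b} are unaffected.  Hence a k-Bruhat cover u ⋖ u(a b)
-- has u(a) < u(b) with no intermediate value in between.  Along a chain the values at
-- positions ≤ k only grow, those at positions > k only shrink and keep their relative order,
-- and every position ≤ k whose value grows occurs as some a_i.
-- If the chain is the CM-chain, (I) and (II) for [u_{i-1}, w]_k forbid an inversion between
-- (a_i, b_i) and any later label.  Conversely, without inversions the first label a maximises
-- w among the positions ≤ k that grow, which is (I), and an induction along the chain shows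
-- that w(b) is minimal as required by (II).

module Submission where

open import Defs
open import Data.Bool using (true; false; if_then_else_)
open import Data.Bool.Properties using (T-≡)
open import Data.Empty using (⊥; ⊥-elim)
open import Data.List using (map; applyUpTo)
open import Data.List.Relation.Unary.All using (All; []; _∷_; lookupAny)
import Data.List.Relation.Unary.All as All
open import Data.List.Relation.Unary.Any using (Any; here; there)
open import Data.List.Relation.Unary.AllPairs using ([]; _∷_)
open import Data.Nat
open import Data.Nat.ListAction using (sum)
open import Data.Nat.Properties
open import Data.Nat.Solver using (module +-*-Solver)
open import Data.Product using (_×_; _,_; proj₁; proj₂)
open import Data.Sum using (inj₁; inj₂)
open import Data.Unit using (tt)
open import Function.Base using (_∘_)
open import Function.Bundles using (_⇔_; mk⇔; Equivalence)
open import Relation.Binary.Definitions using (tri<; tri≈; tri>)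
open import Relation.Binary.PropositionalEquality
  using (_≡_; _≢_; _≗_; refl; sym; trans; cong; cong₂; subst; subst₂; ≢-sym; module ≡-Reasoning)
open import Relation.Nullary using (¬_; yes; no; contradiction)
open +-*-Solver using (solve; _:+_; _:=_)

<ᵇ-true : ∀ {m n} → m < n → (m <ᵇ n) ≡ true
<ᵇ-true m<n = Equivalence.to T-≡ (<⇒<ᵇ m<n)

<ᵇ-false : ∀ {m n} → n ≤ m → (m <ᵇ n) ≡ false
<ᵇ-false {m} {n} n≤m with m <ᵇ n in eq
... | false = refl
... | true  = contradiction (<ᵇ⇒< m n (Equivalence.from T-≡ eq)) (≤⇒≯ n≤m)

≡ᵇ-refl : ∀ n → (n ≡ᵇ n) ≡ true
≡ᵇ-refl n = Equivalence.to T-≡ (≡⇒≡ᵇ n n refl)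

≡ᵇ-false : ∀ {m n} → m ≢ n → (m ≡ᵇ n) ≡ false
≡ᵇ-false {m} {n} m≢n with m ≡ᵇ n in eq
... | false = refl
... | true  = contradiction (≡ᵇ⇒≡ m n (Equivalence.from T-≡ eq)) m≢n

≡ᵇ-false⇒≢ : ∀ {m n} → (m ≡ᵇ n) ≡ false → m ≢ n
≡ᵇ-false⇒≢ {m} eq refl = contradiction (trans (sym (≡ᵇ-refl m)) eq) λ ()

[_<_] : ℕ → ℕ → ℕ
[ m < n ] = if m <ᵇ n then 1 else 0

[<]-true : ∀ {m n} → m < n → [ m < n ] ≡ 1
[<]-true m<n rewrite <ᵇ-true m<n = refl

[<]-false : ∀ {m n} → n ≤ m → [ m < n ] ≡ 0
[<]-false n≤m rewrite <ᵇ-false n≤m = refl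

[<]-mono : ∀ {m m′ n n′} → m′ ≤ m → n ≤ n′ → [ m < n ] ≤ [ m′ < n′ ]
[<]-mono {m} {m′} {n} {n′} m′≤m n≤n′ with m <ᵇ n in eq
... | false = z≤n
... | true  = ≤-reflexive (sym ([<]-true (≤-<-trans m′≤m (<-≤-trans m<n n≤n′))))
  where m<n = <ᵇ⇒< m n (Equivalence.from T-≡ eq)

∑ : ℕ → (ℕ → ℕ) → ℕ
∑ zero    h = 0
∑ (suc n) h = h 0 + ∑ n (h ∘ suc)

sum-map-applyUpTo : ∀ (h g : ℕ → ℕ) n → sum (map h (applyUpTo g n)) ≡ ∑ n (h ∘ g)
sum-map-applyUpTo h g zero    = refl
sum-map-applyUpTo h g (suc n) = cong (h (g 0) +_) (sum-map-applyUpTo h (g ∘ suc) n)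

∑-cong : ∀ n {h h′ : ℕ → ℕ} → (∀ i → i < n → h i ≡ h′ i) → ∑ n h ≡ ∑ n h′
∑-cong zero    eq = refl
∑-cong (suc n) eq = cong₂ _+_ (eq 0 z<s) (∑-cong n (λ i i<n → eq (suc i) (s<s i<n)))

∑-mono-≤ : ∀ n {h h′ : ℕ → ℕ} → (∀ i → i < n → h i ≤ h′ i) → ∑ n h ≤ ∑ n h′
∑-mono-≤ zero    le = z≤n
∑-mono-≤ (suc n) le = +-mono-≤ (le 0 z<s) (∑-mono-≤ n (λ i i<n → le (suc i) (s<s i<n)))

∑-mono-≤-at : ∀ n {h h′ : ℕ → ℕ} {q d} → q < n → (∀ i → i < n → h i ≤ h′ i) →
  d + h q ≤ h′ q → d + ∑ n h ≤ ∑ n h′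
∑-mono-≤-at (suc n) {h = h} {q = zero} {d = d} _ le at-q =
  ≤-trans (≤-reflexive (sym (+-assoc d (h 0) _)))
    (+-mono-≤ at-q (∑-mono-≤ n (λ i i<n → le (suc i) (s<s i<n))))
∑-mono-≤-at (suc n) {h = h} {q = suc q} {d = d} (s<s q<n) le at-q =
  ≤-trans (≤-reflexive (solve 3 (λ x y z → x :+ (y :+ z) := y :+ (x :+ z)) refl d (h 0) _))
    (+-mono-≤ (le 0 z<s) (∑-mono-≤-at n q<n (λ i i<n → le (suc i) (s<s i<n)) at-q))

∑-distrib-+ : ∀ n (h h′ : ℕ → ℕ) → ∑ n (λ i → h i + h′ i) ≡ ∑ n h + ∑ n h′
∑-distrib-+ zero    h h′ = refl
∑-distrib-+ (suc n) h h′ rewrite ∑-distrib-+ n (h ∘ suc) (h′ ∘ suc) =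
  solve 4 (λ x y s t → (x :+ y) :+ (s :+ t) := (x :+ s) :+ (y :+ t)) refl
    (h 0) (h′ 0) (∑ n (h ∘ suc)) (∑ n (h′ ∘ suc))

∑-zero : ∀ n {h : ℕ → ℕ} → (∀ i → i < n → h i ≡ 0) → ∑ n h ≡ 0
∑-zero zero    eq = refl
∑-zero (suc n) eq rewrite eq 0 z<s = ∑-zero n (λ i i<n → eq (suc i) (s<s i<n))

∑-suc : ∀ n h → ∑ (suc n) h ≡ ∑ n h + h n
∑-suc zero    h = +-comm (h 0) 0
∑-suc (suc n) h rewrite ∑-suc n (h ∘ suc) = sym (+-assoc (h 0) _ _)

∑-truncate : ∀ {j N} (t : ℕ → ℕ) → j ≤ N → ∑ j t ≡ ∑ N (λ i → if i <ᵇ j then t i else 0)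
∑-truncate {zero}  {N}     t _         = sym (∑-zero N (λ _ _ → refl))
∑-truncate {suc j} {suc N} t (s≤s j≤N) = cong (t 0 +_) (∑-truncate (t ∘ suc) j≤N)

mask : ℕ → (ℕ → ℕ) → ℕ → ℕ
mask a h i = if i ≡ᵇ a then 0 else h i

except : ℕ → ℕ → (ℕ → ℕ) → ℕ → ℕ
except a b h = mask b (mask a h)

∑-extract : ∀ n a (h : ℕ → ℕ) → a < n → ∑ n h ≡ h a + ∑ n (mask a h)
∑-extract (suc n) zero    h _         = refl
∑-extract (suc n) (suc a) h (s≤s a<n) rewrite ∑-extract n a (h ∘ suc) a<n =
  solve 3 (λ x y z → x :+ (y :+ z) := y :+ (x :+ z)) refl (h 0) (h (suc a)) _

∑-except : ∀ {N a b} (h : ℕ → ℕ) → a < N → b < N → a ≢ b →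
  ∑ N h ≡ h a + (h b + ∑ N (except a b h))
∑-except {N} {a} {b} h a<N b<N a≢b =
  trans (∑-extract N a h a<N)
    (cong (h a +_) (trans (∑-extract N b (mask a h) b<N)
      (cong (_+ ∑ N (except a b h)) mask-at-b)))
  where
  mask-at-b : mask a h b ≡ h b
  mask-at-b rewrite ≡ᵇ-false (a≢b ∘ sym) = refl

except-at : ∀ a b (h : ℕ → ℕ) q → q ≢ a → q ≢ b → except a b h q ≡ h q
except-at a b h q q≢a q≢b rewrite ≡ᵇ-false q≢b | ≡ᵇ-false q≢a = refl

except-mono-≤ : ∀ a b {h h′ : ℕ → ℕ} → (∀ i → i ≢ a → i ≢ b → h i ≤ h′ i) →
  ∀ i → except a b h i ≤ except a b h′ i
except-mono-≤ a b le i with i ≡ᵇ b in eq-b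
... | true  = z≤n
... | false with i ≡ᵇ a in eq-a
...   | true  = z≤n
...   | false = le i (≡ᵇ-false⇒≢ eq-a) (≡ᵇ-false⇒≢ eq-b)

except-cong : ∀ a b {h h′ : ℕ → ℕ} → (∀ i → i ≢ a → i ≢ b → h i ≡ h′ i) →
  ∀ i → except a b h i ≡ except a b h′ i
except-cong a b eq i = ≤-antisym (except-mono-≤ a b (λ i p q → ≤-reflexive (eq i p q)) i)
                                 (except-mono-≤ a b (λ i p q → ≤-reflexive (sym (eq i p q))) i)

except-+ : ∀ a b (h h′ : ℕ → ℕ) i → except a b (λ x → h x + h′ x) i ≡ except a b h i + except a b h′ i
except-+ a b h h′ i with i ≡ᵇ b
... | true  = refl
... | false with i ≡ᵇ a
...   | true  = refl
...   | false = refl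

∑-except-distrib-+ : ∀ N a b (h h′ : ℕ → ℕ) →
  ∑ N (except a b (λ x → h x + h′ x)) ≡ ∑ N (except a b h) + ∑ N (except a b h′)
∑-except-distrib-+ N a b h h′ =
  trans (∑-cong N (λ i _ → except-+ a b h h′ i)) (∑-distrib-+ N (except a b h) (except a b h′))


inverted : (ℕ → ℕ) → ℕ → ℕ → ℕ
inverted f i j = if i <ᵇ j then [ f j < f i ] else 0

∑∑ : ℕ → (ℕ → ℕ → ℕ) → ℕ
∑∑ N t = ∑ N λ j → ∑ N λ i → t i j

inversions : (ℕ → ℕ) → ℕ → ℕ
inversions f N = ∑∑ N (inverted f)

invCount≡∑ : ∀ f N → invCount f N ≡ ∑ N (λ j → ∑ j (λ i → [ f j < f i ]))
invCount≡∑ f N =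
  trans (sum-map-applyUpTo _ (λ i → i) N) (∑-cong N (λ j _ → sum-map-applyUpTo _ (λ i → i) j))

invCount≡inversions : ∀ f N → invCount f N ≡ inversions f N
invCount≡inversions f N =
  trans (invCount≡∑ f N) (∑-cong N (λ j j<N → ∑-truncate _ (<⇒≤ j<N)))

perm-injective : (p : Perm) {x y : ℕ} → fun p x ≡ fun p y → x ≡ y
perm-injective p {x} {y} eq = trans (sym (inv-fun p x)) (trans (cong (inv p) eq) (inv-fun p y))

perm-<-bound : (p : Perm) {N i : ℕ} → bound p ≤ N → i < N → fun p i < N
perm-<-bound p {N} {i} bound≤N i<N with fun p i <? N
... | yes pi<N = pi<N
... | no  pi≮N = contradiction (subst (_< N) (sym fixed) i<N) pi≮N
  where
  fixed : fun p i ≡ i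
  fixed = perm-injective p (fix-big p (fun p i) (≤-trans bound≤N (≮⇒≥ pi≮N)))

invCount-stable : (p : Perm) {N : ℕ} → bound p ≤ N → invCount (fun p) (suc N) ≡ invCount (fun p) N
invCount-stable p {N} bound≤N = begin
  invCount (fun p) (suc N)  ≡⟨ invCount≡∑ (fun p) (suc N) ⟩
  ∑ (suc N) row             ≡⟨ ∑-suc N row ⟩
  ∑ N row + row N           ≡⟨ cong (∑ N row +_) (∑-zero N last-row-empty) ⟩
  ∑ N row + 0               ≡⟨ +-identityʳ _ ⟩
  ∑ N row                   ≡⟨ sym (invCount≡∑ (fun p) N) ⟩
  invCount (fun p) N        ∎
  where
  open ≡-Reasoning
  row : ℕ → ℕ
  row j = ∑ j (λ i → [ fun p j < fun p i ])
  last-row-empty : ∀ i → i < N → [ fun p N < fun p i ] ≡ 0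
  last-row-empty i i<N =
    [<]-false (subst (fun p i ≤_) (sym (fix-big p N bound≤N)) (<⇒≤ (perm-<-bound p bound≤N i<N)))

invCount-above-bound : (p : Perm) (d : ℕ) → invCount (fun p) (d + bound p) ≡ ℓ p
invCount-above-bound p zero    = refl
invCount-above-bound p (suc d) =
  trans (invCount-stable p (m≤n+m (bound p) d)) (invCount-above-bound p d)

ℓ≡inversions : (p : Perm) {N : ℕ} → bound p ≤ N → ℓ p ≡ inversions (fun p) N
ℓ≡inversions p {N} bound≤N = begin
  ℓ p                                      ≡⟨ sym (invCount-above-bound p (N ∸ bound p)) ⟩
  invCount (fun p) (N ∸ bound p + bound p) ≡⟨ cong (invCount (fun p)) (m∸n+n≡m bound≤N) ⟩
  invCount (fun p) N                       ≡⟨ invCount≡inversions (fun p) N ⟩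
  inversions (fun p) N                     ∎
  where open ≡-Reasoning

incident : (ℕ → ℕ → ℕ) → ℕ → ℕ → ℕ → ℕ
incident t a b q = (t q a + t q b) + (t a q + t b q)

∑∑-except : ℕ → ℕ → ℕ → (ℕ → ℕ → ℕ) → ℕ
∑∑-except a b N t = ∑ N (except a b λ j → ∑ N (except a b λ i → t i j))

∑∑-split : ∀ {N a b} (t : ℕ → ℕ → ℕ) → a < N → b < N → a ≢ b →
  ∑∑ N t ≡ ((t a a + t b b) + (t b a + t a b))
           + (∑ N (except a b (incident t a b)) + ∑∑-except a b N t)
∑∑-split {N} {a} {b} t a<N b<N a≢b = begin
    ∑ N column
  ≡⟨ ∑-except column a<N b<N a≢b ⟩
    column a + (column b + ∑ N (except a b column))
  ≡⟨ cong₂ (λ x y → x + (y + ∑ N (except a b column)))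
       (∑-except (λ i → t i a) a<N b<N a≢b) (∑-except (λ i → t i b) a<N b<N a≢b) ⟩
    (t a a + (t b a + Xa)) + ((t a b + (t b b + Xb)) + ∑ N (except a b column))
  ≡⟨ cong (λ x → (t a a + (t b a + Xa)) + ((t a b + (t b b + Xb)) + x)) columns-away ⟩
    (t a a + (t b a + Xa)) + ((t a b + (t b b + Xb)) + ((Ya + Yb) + Z))
  ≡⟨ solve 9 (λ aa ba xa ab bb xb ya yb z →
         (aa :+ (ba :+ xa)) :+ ((ab :+ (bb :+ xb)) :+ ((ya :+ yb) :+ z))
      := ((aa :+ bb) :+ (ba :+ ab)) :+ (((xa :+ xb) :+ (ya :+ yb)) :+ z))
       refl (t a a) (t b a) Xa (t a b) (t b b) Xb Ya Yb Z ⟩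
    ((t a a + t b b) + (t b a + t a b)) + (((Xa + Xb) + (Ya + Yb)) + Z)
  ≡⟨ cong (λ x → ((t a a + t b b) + (t b a + t a b)) + (x + Z)) (sym incident-sum) ⟩
    ((t a a + t b b) + (t b a + t a b)) + (∑ N (except a b (incident t a b)) + Z)
  ∎
  where
  open ≡-Reasoning
  column : ℕ → ℕ
  column j = ∑ N (λ i → t i j)
  Xa Xb Ya Yb Z : ℕ
  Xa = ∑ N (except a b (λ i → t i a))
  Xb = ∑ N (except a b (λ i → t i b))
  Ya = ∑ N (except a b (t a))
  Yb = ∑ N (except a b (t b))
  Z  = ∑∑-except a b N t
  columns-away : ∑ N (except a b column) ≡ (Ya + Yb) + Z
  columns-away =
    trans (∑-cong N (λ j _ → except-cong a b (λ j _ _ →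
             trans (∑-except (λ i → t i j) a<N b<N a≢b) (sym (+-assoc (t a j) (t b j) _))) j))
      (trans (∑-except-distrib-+ N a b (λ j → t a j + t b j) _)
        (cong (_+ Z) (∑-except-distrib-+ N a b (t a) (t b))))
  incident-sum : ∑ N (except a b (incident t a b)) ≡ (Xa + Xb) + (Ya + Yb)
  incident-sum = trans (∑-except-distrib-+ N a b _ _)
    (cong₂ _+_ (∑-except-distrib-+ N a b _ _) (∑-except-distrib-+ N a b _ _))

swap-at-a : ∀ a b → swap a b a ≡ b
swap-at-a a b rewrite ≡ᵇ-refl a = refl

swap-at-b : ∀ {a b} → a ≢ b → swap a b b ≡ a
swap-at-b {a} {b} a≢b rewrite ≡ᵇ-false (a≢b ∘ sym) | ≡ᵇ-refl b = refl

swap-elsewhere : ∀ {a b q} → q ≢ a → q ≢ b → swap a b q ≡ q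
swap-elsewhere q≢a q≢b rewrite ≡ᵇ-false q≢a | ≡ᵇ-false q≢b = refl

swap-involutive : ∀ {a b} → a ≢ b → ∀ i → swap a b (swap a b i) ≡ i
swap-involutive {a} {b} a≢b i with i ≟ a | i ≟ b
... | yes refl | _        rewrite swap-at-a a b = swap-at-b a≢b
... | no _     | yes refl rewrite swap-at-b a≢b = swap-at-a a b
... | no i≢a   | no i≢b   rewrite swap-elsewhere i≢a i≢b = swap-elsewhere i≢a i≢b

module _ {f g : ℕ → ℕ} {a b : ℕ} (a<b : a < b) (g≗f∘swap : g ≗ f ∘ swap a b) (fa<fb : f a < f b) where

  private
    a≢b : a ≢ b
    a≢b = <⇒≢ a<b

    g-at-a : g a ≡ f b
    g-at-a = trans (g≗f∘swap a) (cong f (swap-at-a a b))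

    g-at-b : g b ≡ f a
    g-at-b = trans (g≗f∘swap b) (cong f (swap-at-b a≢b))

    g-elsewhere : ∀ {q} → q ≢ a → q ≢ b → g q ≡ f q
    g-elsewhere q≢a q≢b = trans (g≗f∘swap _) (cong f (swap-elsewhere q≢a q≢b))

    pair : (ℕ → ℕ) → ℕ
    pair h = (inverted h a a + inverted h b b) + (inverted h b a + inverted h a b)

    pair-f : pair f ≡ 0
    pair-f rewrite <ᵇ-false (≤-refl {a}) | <ᵇ-false (≤-refl {b}) | <ᵇ-false (<⇒≤ a<b)
                 | <ᵇ-true a<b | [<]-false (<⇒≤ fa<fb) = refl

    pair-g : pair g ≡ 1
    pair-g rewrite <ᵇ-false (≤-refl {a}) | <ᵇ-false (≤-refl {b}) | <ᵇ-false (<⇒≤ a<b)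
                 | <ᵇ-true a<b | g-at-a | g-at-b | [<]-true fa<fb = refl

    incident-f-between : ∀ {q} → a < q → q < b →
      incident (inverted f) a b q ≡ [ f b < f q ] + ([ f q < f a ] + 0)
    incident-f-between a<q q<b
      rewrite <ᵇ-false (<⇒≤ a<q) | <ᵇ-true q<b | <ᵇ-true a<q | <ᵇ-false (<⇒≤ q<b) = refl

    incident-g-between : ∀ {q} → a < q → q < b →
      incident (inverted g) a b q ≡ [ f a < f q ] + ([ f q < f b ] + 0)
    incident-g-between a<q q<b
      rewrite <ᵇ-false (<⇒≤ a<q) | <ᵇ-true q<b | <ᵇ-true a<q | <ᵇ-false (<⇒≤ q<b)
            | g-at-a | g-at-b | g-elsewhere (≢-sym (<⇒≢ a<q)) (<⇒≢ q<b) = refl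

    incident-mono : ∀ q → q ≢ a → q ≢ b → incident (inverted f) a b q ≤ incident (inverted g) a b q
    incident-mono q q≢a q≢b with <-cmp q a
    ... | tri≈ _ q≡a _ = contradiction q≡a q≢a
    ... | tri< q<a _ _
      rewrite <ᵇ-true q<a | <ᵇ-true (<-trans q<a a<b) | <ᵇ-false (<⇒≤ q<a)
            | <ᵇ-false (<⇒≤ (<-trans q<a a<b)) | g-at-a | g-at-b | g-elsewhere q≢a q≢b
      = ≤-reflexive (cong (_+ 0) (+-comm [ f a < f q ] [ f b < f q ]))
    ... | tri> _ _ a<q with <-cmp q b
    ...   | tri≈ _ q≡b _ = contradiction q≡b q≢b
    ...   | tri< q<b _ _
      rewrite incident-f-between a<q q<b | incident-g-between a<q q<b
      = +-mono-≤ ([<]-mono {n = f q} (<⇒≤ fa<fb) ≤-refl)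
                 (+-monoˡ-≤ 0 ([<]-mono {m = f q} ≤-refl (<⇒≤ fa<fb)))
    ...   | tri> _ _ b<q
      rewrite <ᵇ-false (<⇒≤ a<q) | <ᵇ-false (<⇒≤ b<q) | <ᵇ-true a<q | <ᵇ-true b<q
            | g-at-a | g-at-b | g-elsewhere q≢a q≢b
      = ≤-reflexive (+-comm [ f q < f a ] [ f q < f b ])

    incident-between : ∀ {q} → a < q → q < b → f a < f q → f q < f b →
      2 + incident (inverted f) a b q ≤ incident (inverted g) a b q
    incident-between a<q q<b fa<fq fq<fb
      rewrite incident-f-between a<q q<b | incident-g-between a<q q<b
            | [<]-false (<⇒≤ fq<fb) | [<]-false (<⇒≤ fa<fq) | [<]-true fa<fq | [<]-true fq<fb = ≤-refl

    inverted-away : ∀ i j → i ≢ a → i ≢ b → j ≢ a → j ≢ b → inverted g i j ≡ inverted f i j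
    inverted-away i j i≢a i≢b j≢a j≢b rewrite g-elsewhere i≢a i≢b | g-elsewhere j≢a j≢b = refl

    ∑∑-except-g≡f : ∀ N → ∑∑-except a b N (inverted g) ≡ ∑∑-except a b N (inverted f)
    ∑∑-except-g≡f N = ∑-cong N (λ j _ → except-cong a b (λ j j≢a j≢b →
      ∑-cong N (λ i _ → except-cong a b (λ i i≢a i≢b → inverted-away i j i≢a i≢b j≢a j≢b) i)) j)

    incidentSum : (ℕ → ℕ) → ℕ → ℕ
    incidentSum h N = ∑ N (except a b (incident (inverted h) a b))

    except-incident-mono : ∀ N i → i < N → except a b (incident (inverted f) a b) i
                                       ≤ except a b (incident (inverted g) a b) i
    except-incident-mono N i _ = except-mono-≤ a b incident-mono i

    inversions-gain : ∀ {N d} → b < N → d + incidentSum f N ≤ incidentSum g N →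
      suc d + inversions f N ≤ inversions g N
    inversions-gain {N} {d} b<N more = begin
      suc d + inversions f N                       ≡⟨ cong (suc d +_) (split f) ⟩
      suc d + (pair f + (incidentSum f N + Rf))
        ≡⟨ cong (λ x → suc d + (x + (incidentSum f N + Rf))) pair-f ⟩
      suc (d + (incidentSum f N + Rf))             ≡⟨ cong suc (sym (+-assoc d _ Rf)) ⟩
      suc ((d + incidentSum f N) + Rf)             ≤⟨ s≤s (+-monoˡ-≤ Rf more) ⟩
      suc (incidentSum g N + Rf)
        ≡⟨ cong (λ x → suc (incidentSum g N + x)) (sym (∑∑-except-g≡f N)) ⟩
      suc (incidentSum g N + Rg)                   ≡⟨ cong (_+ (incidentSum g N + Rg)) (sym pair-g) ⟩
      pair g + (incidentSum g N + Rg)              ≡⟨ sym (split g) ⟩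
      inversions g N                               ∎
      where
      open ≤-Reasoning
      split : ∀ h → inversions h N ≡ pair h + (incidentSum h N + ∑∑-except a b N (inverted h))
      split h = ∑∑-split (inverted h) (<-trans a<b b<N) b<N a≢b
      Rf = ∑∑-except a b N (inverted f)
      Rg = ∑∑-except a b N (inverted g)

  swap-ascent-inversions : ∀ {N} → b < N → suc (inversions f N) ≤ inversions g N
  swap-ascent-inversions {N} b<N = inversions-gain b<N (∑-mono-≤ N (except-incident-mono N))

  swap-ascent-inversions-between : ∀ {N q} → b < N → a < q → q < b → f a < f q → f q < f b →
    3 + inversions f N ≤ inversions g N
  swap-ascent-inversions-between {N} {q} b<N a<q q<b fa<fq fq<fb =
    inversions-gain b<N (∑-mono-≤-at N (<-trans q<b b<N) (except-incident-mono N) at-q)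
    where
    q≢a = ≢-sym (<⇒≢ a<q)
    q≢b = <⇒≢ q<b
    at-q : 2 + except a b (incident (inverted f) a b) q ≤ except a b (incident (inverted g) a b) q
    at-q rewrite except-at a b (incident (inverted f) a b) q q≢a q≢b
               | except-at a b (incident (inverted g) a b) q q≢a q≢b = incident-between a<q q<b fa<fq fq<fb

module _ {a b : ℕ} (p q : Perm) (a<b : a < b) (q≗p∘swap : fun q ≗ fun p ∘ swap a b)
         (pa<pb : fun p a < fun p b) where

  private
    N : ℕ
    N = bound p ⊔ bound q ⊔ suc b

    ℓp : ℓ p ≡ inversions (fun p) N
    ℓp = ℓ≡inversions p (≤-trans (m≤m⊔n (bound p) (bound q)) (m≤m⊔n _ (suc b)))

    ℓq : ℓ q ≡ inversions (fun q) N
    ℓq = ℓ≡inversions q (≤-trans (m≤n⊔m (bound p) (bound q)) (m≤m⊔n _ (suc b)))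

    b<N : b < N
    b<N = m≤n⊔m (bound p ⊔ bound q) (suc b)

  ℓ-swap-ascent : suc (ℓ p) ≤ ℓ q
  ℓ-swap-ascent = subst₂ (λ x y → suc x ≤ y) (sym ℓp) (sym ℓq)
    (swap-ascent-inversions a<b q≗p∘swap pa<pb b<N)

  ℓ-swap-ascent-between : ∀ {c} → a < c → c < b → fun p a < fun p c → fun p c < fun p b → 3 + ℓ p ≤ ℓ q
  ℓ-swap-ascent-between a<c c<b pa<pc pc<pb = subst₂ (λ x y → 3 + x ≤ y) (sym ℓp) (sym ℓq)
    (swap-ascent-inversions-between a<b q≗p∘swap pa<pb b<N a<c c<b pa<pc pc<pb)

-- Cover unfolds to a product, so u and v cannot be inferred from a proof of it: they are explicit here.
module _ {k a b : ℕ} (u v : Perm) (cv : Cover k a b u v) where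

  private
    a≤k : a ≤ k
    a≤k = proj₁ (proj₂ cv)

    k<b : k < b
    k<b = proj₁ (proj₂ (proj₂ cv))

    v≗u∘swap : fun v ≗ fun u ∘ swap a b
    v≗u∘swap = proj₁ (proj₂ (proj₂ (proj₂ cv)))

    >k⇒≢a : ∀ {i} → k < i → i ≢ a
    >k⇒≢a k<i = ≢-sym (<⇒≢ (≤-<-trans a≤k k<i))

  cover-ℓ : ℓ v ≡ suc (ℓ u)
  cover-ℓ = proj₂ (proj₂ (proj₂ (proj₂ cv)))

  cover-a<b : a < b
  cover-a<b = ≤-<-trans a≤k k<b

  cover-at-a : fun v a ≡ fun u b
  cover-at-a = trans (v≗u∘swap a) (cong (fun u) (swap-at-a a b))

  cover-at-b : fun v b ≡ fun u a
  cover-at-b = trans (v≗u∘swap b) (cong (fun u) (swap-at-b (<⇒≢ cover-a<b)))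

  cover-elsewhere : ∀ {i} → i ≢ a → i ≢ b → fun v i ≡ fun u i
  cover-elsewhere i≢a i≢b = trans (v≗u∘swap _) (cong (fun u) (swap-elsewhere i≢a i≢b))

  cover-ascent : fun u a < fun u b
  cover-ascent with <-cmp (fun u a) (fun u b)
  ... | tri< ua<ub _ _ = ua<ub
  ... | tri≈ _ ua≡ub _ = contradiction (perm-injective u ua≡ub) (<⇒≢ cover-a<b)
  ... | tri> _ _ ub<ua = ⊥-elim (1+n≰n (≤-trans (n≤1+n (suc (ℓ u))) too-long))
    where
    u≗v∘swap : fun u ≗ fun v ∘ swap a b
    u≗v∘swap i = sym (trans (v≗u∘swap (swap a b i)) (cong (fun u) (swap-involutive (<⇒≢ cover-a<b) i)))
    too-long : suc (suc (ℓ u)) ≤ ℓ u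
    too-long = subst (λ x → suc x ≤ ℓ u) cover-ℓ
      (ℓ-swap-ascent v u cover-a<b u≗v∘swap (subst₂ _<_ (sym cover-at-a) (sym cover-at-b) ub<ua))

  cover-no-between : ∀ {i} → a < i → i < b → fun u a < fun u i → fun u i < fun u b → ⊥
  cover-no-between a<i i<b ua<ui ui<ub = 1+n≰n (≤-trans (n≤1+n (suc (ℓ u))) (s≤s⁻¹ too-long))
    where
    too-long : 3 + ℓ u ≤ suc (ℓ u)
    too-long = subst (3 + ℓ u ≤_) cover-ℓ
      (ℓ-swap-ascent-between u v cover-a<b v≗u∘swap cover-ascent a<i i<b ua<ui ui<ub)

  cover-mono-≤k : ∀ {i} → i ≤ k → fun u i ≤ fun v i
  cover-mono-≤k {i} i≤k with i ≟ a
  ... | yes refl = subst (fun u a ≤_) (sym cover-at-a) (<⇒≤ cover-ascent)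
  ... | no i≢a   = ≤-reflexive (sym (cover-elsewhere i≢a (<⇒≢ (≤-<-trans i≤k k<b))))

  cover-antimono->k : ∀ {i} → k < i → fun v i ≤ fun u i
  cover-antimono->k {i} k<i with i ≟ b
  ... | yes refl = subst (_≤ fun u b) (sym cover-at-b) (<⇒≤ cover-ascent)
  ... | no i≢b   = ≤-reflexive (cover-elsewhere (>k⇒≢a k<i) i≢b)

  cover-keeps-order->k : ∀ {i j} → k < i → i < j → fun u i < fun u j → fun v i < fun v j
  cover-keeps-order->k {i} {j} k<i i<j ui<uj with i ≟ b | j ≟ b
  ... | yes refl | yes refl = contradiction i<j (<-irrefl refl)
  ... | yes refl | no j≢b   =
    subst₂ _<_ (sym cover-at-b) (sym (cover-elsewhere (>k⇒≢a (<-trans k<i i<j)) j≢b)) (<-trans cover-ascent ui<uj)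
  ... | no i≢b   | yes refl =
    subst₂ _<_ (sym (cover-elsewhere (>k⇒≢a k<i) i≢b)) (sym cover-at-b) ui<ua
    where
    ui<ua : fun u i < fun u a
    ui<ua with fun u i <? fun u a
    ... | yes ui<ua = ui<ua
    ... | no  ui≮ua = ⊥-elim (cover-no-between (≤-<-trans a≤k k<i) i<j
                        (≤∧≢⇒< (≮⇒≥ ui≮ua) (>k⇒≢a k<i ∘ perm-injective u ∘ sym)) ui<uj)
  ... | no i≢b   | no j≢b   =
    subst₂ _<_ (sym (cover-elsewhere (>k⇒≢a k<i) i≢b))
               (sym (cover-elsewhere (>k⇒≢a (<-trans k<i i<j)) j≢b)) ui<uj

private variable
  k a b i j : ℕ
  u v w : Perm

chain-mono-≤k : Chain k v w → i ≤ k → fun v i ≤ fun w i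
chain-mono-≤k done _ = ≤-refl
chain-mono-≤k {v = v} (step {v = v′} _ _ cv c) i≤k =
  ≤-trans (cover-mono-≤k v v′ cv i≤k) (chain-mono-≤k c i≤k)

chain-antimono->k : Chain k v w → k < i → fun w i ≤ fun v i
chain-antimono->k done _ = ≤-refl
chain-antimono->k {v = v} (step {v = v′} _ _ cv c) k<i =
  ≤-trans (chain-antimono->k c k<i) (cover-antimono->k v v′ cv k<i)

chain-ℓ-mono : Chain k v w → ℓ v ≤ ℓ w
chain-ℓ-mono done = ≤-refl
chain-ℓ-mono {v = v} (step {v = v′} _ _ cv c) =
  ≤-trans (≤-trans (n≤1+n (ℓ v)) (≤-reflexive (sym (cover-ℓ v v′ cv)))) (chain-ℓ-mono c)

chain-keeps-order->k : Chain k v w → k < i → i < j → fun v i < fun v j → fun w i < fun w j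
chain-keeps-order->k done _ _ vi<vj = vi<vj
chain-keeps-order->k {v = v} (step {v = v′} _ _ cv c) k<i i<j vi<vj =
  chain-keeps-order->k c k<i i<j (cover-keeps-order->k v v′ cv k<i i<j vi<vj)

changed⇒labelled : (c : Chain k v w) → i ≤ k → fun v i < fun w i → Any (λ l → proj₁ l ≡ i) (labels c)
changed⇒labelled done _ vi<wi = contradiction vi<wi (<-irrefl refl)
changed⇒labelled {v = v} {w} {i} (step {v = v′} a b cv@(_ , _ , k<b , _) c) i≤k vi<wi with a ≟ i
... | yes a≡i = here a≡i
... | no  a≢i = there (changed⇒labelled c i≤k (subst (_< fun w i) v′i≡vi vi<wi))
  where
  v′i≡vi : fun v i ≡ fun v′ i
  v′i≡vi = sym (cover-elsewhere v v′ cv (≢-sym a≢i) (<⇒≢ (≤-<-trans i≤k k<b)))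

LabelProps : ℕ → Perm → Perm → ℕ × ℕ → Set
LabelProps k v w (p , q) = 1 ≤ p × p ≤ k × k < q × fun v p < fun w p × fun v p < fun v q

labels-props : (c : Chain k v w) → All (LabelProps k v w) (labels c)
labels-props done = []
labels-props {k} {v} {w} (step {v = v′} a b cv@(1≤a , a≤k , k<b , _) c) =
  (1≤a , a≤k , k<b , va<wa , cover-ascent v v′ cv) ∷ All.map weaken (labels-props c)
  where
  va<wa : fun v a < fun w a
  va<wa = <-≤-trans (subst (fun v a <_) (sym (cover-at-a v v′ cv)) (cover-ascent v v′ cv))
                    (chain-mono-≤k c a≤k)
  weaken : ∀ {l} → LabelProps k v′ w l → LabelProps k v w l
  weaken {p , q} (1≤p , p≤k , k<q , v′p<wp , v′p<v′q) =
    1≤p , p≤k , k<q , ≤-<-trans vp≤v′p v′p<wp ,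
    ≤-<-trans vp≤v′p (<-≤-trans v′p<v′q (cover-antimono->k v v′ cv k<q))
    where vp≤v′p = cover-mono-≤k v v′ cv p≤k

IsInversion-irrefl : ∀ w l → ¬ IsInversion w l l
IsInversion-irrefl w l (inj₁ lt)       = <-irrefl refl lt
IsInversion-irrefl w l (inj₂ (_ , lt)) = <-irrefl refl lt

uninverted⇒source-max : (c : Chain k v w) → All (λ l → ¬ IsInversion w (a , b) l) (labels c) →
  i ≤ k → fun v i < fun w i → fun w i ≤ fun w a
uninverted⇒source-max {w = w} {a = a} c uninverted i≤k vi<wi
  with lookupAny uninverted (changed⇒labelled c i≤k vi<wi)
... | ¬inversion , first≡i = subst (λ x → fun w x ≤ fun w a) first≡i (≮⇒≥ (¬inversion ∘ inj₁))

target-min-moved : ∀ {a′ v′} → Cover k a′ j v v′ → (c : Chain k v′ w) → a ≤ k → k < j →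
  ¬ IsInversion w (a , b) (a′ , j) → All (λ l → ¬ IsInversion w (a′ , j) l) (labels c) →
  fun v a < fun v j → fun w b ≤ fun w j
target-min-moved {j = j} {v = v} {w = w} {a = a} {a′ = a′} {v′ = v′} cv c a≤k k<j ¬inv uninverted′ va<vj
  with a′ ≟ a
... | yes refl = ≮⇒≥ (λ wj<wb → ¬inv (inj₂ (refl , wj<wb)))
... | no  a′≢a = ⊥-elim (<⇒≱ wa′<wa (uninverted⇒source-max c uninverted′ a≤k v′a<wa))
  where
  wa′<wa : fun w a′ < fun w a
  wa′<wa = ≤∧≢⇒< (≮⇒≥ (¬inv ∘ inj₁)) (a′≢a ∘ perm-injective w)
  v′a<wa : fun v′ a < fun w a
  v′a<wa = begin-strict
    fun v′ a   ≡⟨ cover-elsewhere v v′ cv (a′≢a ∘ sym) (<⇒≢ (≤-<-trans a≤k k<j)) ⟩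
    fun v a    <⟨ va<vj ⟩
    fun v j    ≡⟨ sym (cover-at-a v v′ cv) ⟩
    fun v′ a′  ≤⟨ chain-mono-≤k c (proj₁ (proj₂ cv)) ⟩
    fun w a′   <⟨ wa′<wa ⟩
    fun w a    ∎
    where open ≤-Reasoning

uninverted⇒target-min : (c : Chain k v w) → a ≤ k → k < j →
  All (λ l → ¬ IsInversion w (a , b) l) (labels c) → NoInversions c →
  fun v a < fun v j → fun w j < fun v j → fun w b ≤ fun w j

target-min-kept : ∀ {a′ b′ v′} → Cover k a′ b′ v v′ → (c : Chain k v′ w) → a ≤ k → k < j →
  j ≢ b′ → fun v′ j ≡ fun v j →
  ¬ IsInversion w (a , b) (a′ , b′) → All (λ l → ¬ IsInversion w (a , b) l) (labels c) →
  NoInversions c →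
  fun v a < fun v j → fun w j < fun v j → fun w b ≤ fun w j

uninverted⇒target-min done _ _ _ _ _ wj<vj = contradiction wj<vj (<-irrefl refl)
uninverted⇒target-min {v = v} {j = j} (step {v = v′} a′ b′ cv@(_ , a′≤k , _) c) a≤k k<j
                      (¬inv ∷ uninverted) (uninverted′ ∷ noInv) va<vj wj<vj with j ≟ b′
... | yes refl = target-min-moved {v = v} {v′ = v′} cv c a≤k k<j ¬inv uninverted′ va<vj
... | no  j≢b′ =
  target-min-kept {v = v} {v′ = v′} cv c a≤k k<j j≢b′ v′j≡vj ¬inv uninverted noInv va<vj wj<vj
  where
  v′j≡vj : fun v′ j ≡ fun v j
  v′j≡vj = cover-elsewhere v v′ cv (≢-sym (<⇒≢ (≤-<-trans a′≤k k<j))) j≢b′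

target-min-kept {v = v} {w = w} {a = a} {j = j} {a′ = a′} {b′ = b′} {v′ = v′}
                cv c a≤k k<j j≢b′ v′j≡vj ¬inv uninverted noInv va<vj wj<vj
  with a′ ≟ a
... | yes refl with <-cmp (fun v b′) (fun v j)
...   | tri< vb′<vj _ _ = uninverted⇒target-min c a≤k k<j uninverted noInv
          (subst₂ _<_ (sym (cover-at-a v v′ cv)) (sym v′j≡vj) vb′<vj)
          (subst (fun w j <_) (sym v′j≡vj) wj<vj)
...   | tri≈ _ vb′≡vj _ = contradiction (perm-injective v vb′≡vj) (j≢b′ ∘ sym)
...   | tri> _ _ vj<vb′ with <-cmp j b′
...     | tri< j<b′ _ _ = ⊥-elim (cover-no-between v v′ cv (≤-<-trans a≤k k<j) j<b′ va<vj vj<vb′)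
...     | tri≈ _ j≡b′ _ = contradiction j≡b′ j≢b′
...     | tri> _ _ b′<j = ≤-trans (≮⇒≥ (λ wb′<wb → ¬inv (inj₂ (refl , wb′<wb))))
          (<⇒≤ (chain-keeps-order->k c (proj₁ (proj₂ (proj₂ cv))) b′<j
                  (subst₂ _<_ (sym (cover-at-b v v′ cv)) (sym v′j≡vj) va<vj)))
target-min-kept {v = v} {w = w} {a = a} {j = j} {a′ = a′} {b′ = b′} {v′ = v′}
                cv@(_ , _ , k<b′ , _) c a≤k k<j j≢b′ v′j≡vj
                ¬inv uninverted noInv va<vj wj<vj
    | no a′≢a = uninverted⇒target-min c a≤k k<j uninverted noInv
                  (subst₂ _<_ (sym v′a≡va) (sym v′j≡vj) va<vj) (subst (fun w j <_) (sym v′j≡vj) wj<vj)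
  where
  v′a≡va : fun v′ a ≡ fun v a
  v′a≡va = cover-elsewhere v v′ cv (a′≢a ∘ sym) (<⇒≢ (≤-<-trans a≤k k<b′))

first-label-uninverted : ∀ {u₁ l} → Cover k a b u u₁ → CondI k u w a → CondII k u w a b →
  LabelProps k u₁ w l → ¬ IsInversion w (a , b) l
first-label-uninverted {u = u} {u₁ = u₁} cv (_ , _ , _ , a-max) _ (1≤p , p≤k , _ , u₁p<wp , _)
                       (inj₁ wa<wp) =
  <⇒≱ wa<wp (a-max _ 1≤p p≤k (≤-<-trans (cover-mono-≤k u u₁ cv p≤k) u₁p<wp))
first-label-uninverted {a = a} {u = u} {w = w} {u₁ = u₁} {l = _ , q} cv@(_ , a≤k , _) _ (_ , _ , wb≤ua , b-min)
                       (_ , _ , k<q , _ , u₁a<u₁q) (inj₂ (wa≡wp , wq<wb)) with perm-injective w wa≡wp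
... | refl = <⇒≱ wq<wb (b-min q k<q ua<uq (<⇒≤ (<-≤-trans wq<wb wb≤ua)))
  where
  q≢b : q ≢ _
  q≢b q≡b = <-irrefl (cong (fun w) q≡b) wq<wb
  ua<uq : fun u a < fun u q
  ua<uq = begin-strict
    fun u a    <⟨ cover-ascent u u₁ cv ⟩
    fun u _    ≡⟨ sym (cover-at-a u u₁ cv) ⟩
    fun u₁ a   <⟨ u₁a<u₁q ⟩
    fun u₁ q   ≡⟨ cover-elsewhere u u₁ cv (≢-sym (<⇒≢ (≤-<-trans a≤k k<q))) q≢b ⟩
    fun u q    ∎
    where open ≤-Reasoning

IsCM⇒NoInversions : (c : Chain k u w) → IsCM c → NoInversions c
IsCM⇒NoInversions done ()
IsCM⇒NoInversions (step _ _ _ done) (inj₁ _) = [] ∷ []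
IsCM⇒NoInversions (step _ _ _ (step _ _ _ _)) (inj₁ (_ , ()))
IsCM⇒NoInversions {u = u} {w = w} (step {v = u₁} a b cv c) (inj₂ (_ , condI , condII , cm)) =
  All.map (first-label-uninverted {u = u} {w = w} {u₁ = u₁} cv condI condII) (labels-props c)
  ∷ IsCM⇒NoInversions c cm

NoInversions⇒IsCM : (c : Chain k u w) → ¬ IsDone c → NoInversions c → IsCM c
NoInversions⇒IsCM done nonempty _ = ⊥-elim (nonempty tt)
NoInversions⇒IsCM {u = u} (step {v = u₁} a b cv done) _ _ = inj₁ (cover-ℓ u u₁ cv , tt)
NoInversions⇒IsCM {k} {u} {w} (step {v = u₁} a b cv c@(step {v = u₂} _ _ cv₂ c′)) _
                  noInv@(uninverted ∷ noInv′) =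
  inj₂ (ℓ-grows , condI , condII , NoInversions⇒IsCM c (λ ()) noInv′)
  where
  full : Chain k u w
  full = step a b cv c
  uninverted-full : All (λ l → ¬ IsInversion w (a , b) l) (labels full)
  uninverted-full = IsInversion-irrefl w (a , b) ∷ uninverted
  ℓ-grows : suc (ℓ u) < ℓ w
  ℓ-grows = begin-strict
    suc (ℓ u)   ≡⟨ sym (cover-ℓ u u₁ cv) ⟩
    ℓ u₁        <⟨ n<1+n (ℓ u₁) ⟩
    suc (ℓ u₁)  ≡⟨ sym (cover-ℓ u₁ u₂ cv₂) ⟩
    ℓ u₂        ≤⟨ chain-ℓ-mono c′ ⟩
    ℓ w         ∎
    where open ≤-Reasoning
  condI : CondI k u w a
  condI with All.head (labels-props full)
  ... | 1≤a , a≤k , _ , ua<wa , _ =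
    1≤a , a≤k , ua<wa , λ j _ j≤k uj<wj → uninverted⇒source-max full uninverted-full j≤k uj<wj
  condII : CondII k u w a b
  condII with All.head (labels-props full)
  ... | _ , a≤k , k<b , _ , ua<ub =
    k<b , ua<ub , subst (fun w b ≤_) (cover-at-b u u₁ cv) (chain-antimono->k c k<b) ,
    λ j k<j ua<uj wj≤ua →
      uninverted⇒target-min full a≤k k<j uninverted-full noInv ua<uj (≤-<-trans wj≤ua ua<uj)

chain-nonempty : (c : Chain k u w) → ¬ (fun u ≗ fun w) → ¬ IsDone c
chain-nonempty done u≉w _ = u≉w (λ _ → refl)
chain-nonempty (step _ _ _ _) _ ()

lemma3p4 : (k : ℕ) → 1 ≤ k → (u w : Perm) → u <[ k ] w →
    (c : Chain k u w) → (IsCM c ⇔ NoInversions c)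
lemma3p4 k _ u w (_ , u≉w) c = mk⇔ (IsCM⇒NoInversions c) (NoInversions⇒IsCM c (chain-nonempty c u≉w))
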